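{- Let $G$ be a connected graph. If $G$ contains neither $\overline{C_3^*}$ nor $\overline{S_3}$ as an induced subgraph, then $G$ contains no induced subgraph isomorphic to $C_\ell^*$ for any $\ell\ge 5$.
   Context: $C_\ell$ denotes the cycle on $\ell$ vertices (as an induced subgraph, a chordless cycle); $C_\ell^*$ is obtained from $C_\ell$ by adding an isolated vertex. $\overline{H}$ denotes the complement of $H$; $\overline{C_3^*}$ is the claw $K_{1,3}$. $S_3$ (the tent) has vertices $a_1,a_2,a_3,b_1,b_2,b_3$, where $a_1a_2a_3$ is a triangle and $b_i$ is adjacent exactly to $a_i$ and $a_{i+1}$ (indices mod 3); $\overline{S_3}$ (the net) is a triangle with one pendant vertex attached to each of its three vertices. -}

module Defs where

open import Data.Nat using (ℕ; zero; suc; _+_; _<_; _≥_)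
open import Data.Fin using (Fin; toℕ; zero; suc)
open import Data.Bool using (Bool; true; false; _∨_; _∧_; not)
open import Data.List using (List; []; _∷_)
open import Data.Product using (Σ; _×_; _,_)
open import Data.Empty using (⊥)
open import Relation.Binary.PropositionalEquality using (_≡_)
open import Relation.Nullary using (¬_; does)
open import Function.Definitions using (Injective)

record Graph : Set where
  field
    n     : ℕ
    adj   : Fin n → Fin n → Bool
    sym   : ∀ u v → adj u v ≡ adj v u
    irrefl : ∀ v → adj v v ≡ false
open Graph public

data Walk (G : Graph) : Fin (n G) → Fin (n G) → Set where
  here : ∀ {u} → Walk G u u
  step : ∀ {u w v} → adj G u w ≡ true → Walk G w v → Walk G u v

Connected : Graph → Set
Connected G = ∀ u v → Walk G u v

InducedSub : (k : ℕ) → (Fin k → Fin k → Bool) → Graph → Set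
InducedSub k A G =
  Σ (Fin k → Fin (n G)) λ f →
    Injective _≡_ _≡_ f × (∀ i j → adj G (f i) (f j) ≡ A i j)

_==_ : ℕ → ℕ → Bool
m == k = does (m Data.Nat.≟ k)

cycAdj : (ℓ : ℕ) → Fin ℓ → Fin ℓ → Bool
cycAdj ℓ i j =
  (toℕ j == suc (toℕ i)) ∨ (toℕ i == suc (toℕ j))
  ∨ ((toℕ i == 0) ∧ (suc (toℕ j) == ℓ))
  ∨ ((toℕ j == 0) ∧ (suc (toℕ i) == ℓ))

-- Adjacency of C_ℓ^*: vertices Fin (suc ℓ); vertex 0 is isolated and
-- vertex (suc i) is cycle vertex i.
cycStarAdj : (ℓ : ℕ) → Fin (suc ℓ) → Fin (suc ℓ) → Bool
cycStarAdj ℓ zero    _       = false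
cycStarAdj ℓ (suc i) zero    = false
cycStarAdj ℓ (suc i) (suc j) = cycAdj ℓ i j

fromEdges : {k : ℕ} → List (ℕ × ℕ) → Fin k → Fin k → Bool
fromEdges [] i j = false
fromEdges ((a , b) ∷ es) i j =
  ((toℕ i == a) ∧ (toℕ j == b)) ∨ ((toℕ i == b) ∧ (toℕ j == a))
  ∨ fromEdges es i j

-- complement of C_3^* = claw K_{1,3}: centre 0, leaves 1,2,3.
clawAdj : Fin 4 → Fin 4 → Bool
clawAdj = fromEdges ((0 , 1) ∷ (0 , 2) ∷ (0 , 3) ∷ [])

-- complement of S_3 = net: triangle 0,1,2 with pendant vertices 3,4,5
-- attached to 0,1,2 respectively.
netAdj : Fin 6 → Fin 6 → Bool
netAdj = fromEdges ((0 , 1) ∷ (1 , 2) ∷ (0 , 2) ∷ (0 , 3) ∷ (1 , 4) ∷ (2 , 5) ∷ [])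

-- Call a vertex far if it has no neighbour on the induced cycle c₀ … c₍ℓ₋₁₎.  The isolated
-- vertex of C_ℓ^* is far and, G being connected, is joined to the cycle by a walk, so it suffices
-- that every neighbour v of a far vertex u is far.  Suppose v ~ cᵢ.  If v sees neither cᵢ₋₁ nor
-- cᵢ₊₁, then cᵢ centres a claw with leaves cᵢ₋₁, cᵢ₊₁, v.  Otherwise v sees both middle vertices
-- x₁, x₂ of an induced path x₀x₁x₂x₃ of the cycle (this needs ℓ ≥ 5), and then either v sees x₀
-- or x₃, giving a claw centred at v with leaf u, or v x₁ x₂ is a triangle with pendant vertices
-- u, x₀, x₃, i.e. a net.

module Submission where

open import Defs hiding (sym)
open import Data.Bool using (Bool; true; false; T; _∨_; _∧_)
open import Data.Bool.Properties using (T-≡; T-∨; T-∧; ¬-not) renaming (_≟_ to _≟ᵇ_)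
open import Data.Empty using (⊥)
open import Data.Fin using (Fin; zero; suc; toℕ; fromℕ; inject₁; _<_; _≟_)
open import Data.Fin.Patterns using (0F; 1F; 2F; 3F; 4F; 5F)
open import Data.Fin.Properties using (toℕ-fromℕ; toℕ-inject₁; toℕ<n; <-cmp; all?)
open import Data.Fin.Relation.Unary.Top using (view; ‵fromℕ; ‵inject₁)
open import Data.Nat using (ℕ; suc; _≤_; _≥_; s≤s)
open import Data.Nat.Properties using (<⇒≢; <⇒≤; ≡ᵇ⇒≡; ≡⇒≡ᵇ)
open import Data.Product using (∃-syntax; _×_; _,_)
open import Data.Product.Function.NonDependent.Propositional using (_×-⇔_)
open import Data.Sum using (_⊎_; inj₁; inj₂)
open import Data.Sum.Function.Propositional using (_⊎-⇔_)
open import Function using (_∘_)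
open import Function.Bundles using (_⇔_; mk⇔; Equivalence)
open import Function.Construct.Composition using (_⇔-∘_)
open import Function.Definitions using (Injective)
open import Relation.Binary.Definitions using (tri<; tri≈; tri>)
open import Relation.Binary.PropositionalEquality using (_≡_; _≢_; refl; sym; trans; cong; subst; ≢-sym)
open import Relation.Nullary using (¬_; contradiction)
open import Relation.Nullary.Decidable using (from-yes; _→-dec_)

TwinFree : ∀ {k} → (Fin k → Fin k → Bool) → Set
TwinFree A = ∀ i j → (∀ z → A z i ≡ A z j) → i ≡ j

netAdj-twinFree : TwinFree netAdj
netAdj-twinFree = from-yes (all? λ i → all? λ j → all? (λ z → netAdj z i ≟ᵇ netAdj z j) →-dec i ≟ j)

netAdj-sym : ∀ i j → netAdj i j ≡ netAdj j i
netAdj-sym = from-yes (all? λ i → all? λ j → netAdj i j ≟ᵇ netAdj j i)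

netAdj-irrefl : ∀ i → netAdj i i ≡ false
netAdj-irrefl = from-yes (all? λ i → netAdj i i ≟ᵇ false)

clawAdj-sym : ∀ i j → clawAdj i j ≡ clawAdj j i
clawAdj-sym = from-yes (all? λ i → all? λ j → clawAdj i j ≟ᵇ clawAdj j i)

clawAdj-irrefl : ∀ i → clawAdj i i ≡ false
clawAdj-irrefl = from-yes (all? λ i → clawAdj i i ≟ᵇ false)

module _ (G : Graph) where

  adj-flip : ∀ {u v b} → adj G u v ≡ b → adj G v u ≡ b
  adj-flip {u} {v} uv = trans (Graph.sym G v u) uv

  separated : ∀ {w x y} → adj G w x ≡ false → adj G w y ≡ true → x ≢ y
  separated wx wy refl = contradiction (trans (sym wx) wy) λ ()

  adjacent⇒≢ : ∀ {x y} → adj G x y ≡ true → x ≢ y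
  adjacent⇒≢ {x} xy = separated (irrefl G x) xy

  module _ {k} {A : Fin k → Fin k → Bool} (g : Fin k → Fin (n G)) where

    adj-from-upper : (∀ i j → A i j ≡ A j i) → (∀ i → A i i ≡ false) →
      (∀ {i j} → i < j → adj G (g i) (g j) ≡ A i j) →
      ∀ i j → adj G (g i) (g j) ≡ A i j
    adj-from-upper A-sym A-irrefl upper i j with <-cmp i j
    ... | tri< i<j _ _ = upper i<j
    ... | tri≈ _ refl _ = trans (irrefl G (g i)) (sym (A-irrefl i))
    ... | tri> _ _ j<i = trans (adj-flip (upper j<i)) (A-sym j i)

    twinFree⇒injective : TwinFree A → (∀ i j → adj G (g i) (g j) ≡ A i j) → Injective _≡_ _≡_ g
    twinFree⇒injective twinFree g-adj {i} {j} gi≡gj = twinFree i j λ z →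
      trans (sym (g-adj z i)) (trans (cong (adj G (g z)) gi≡gj) (g-adj z j))

  pairwise-distinct⇒injective : ∀ {k} (g : Fin k → Fin (n G)) →
    (∀ {i j} → i < j → g i ≢ g j) → Injective _≡_ _≡_ g
  pairwise-distinct⇒injective g distinct {i} {j} gi≡gj with <-cmp i j
  ... | tri< i<j _ _ = contradiction gi≡gj (distinct i<j)
  ... | tri≈ _ i≡j _ = i≡j
  ... | tri> _ _ j<i = contradiction (sym gi≡gj) (distinct j<i)

  induced-claw : ∀ {x a b c} →
    adj G x a ≡ true → adj G x b ≡ true → adj G x c ≡ true →
    adj G a b ≡ false → adj G a c ≡ false → adj G b c ≡ false →
    a ≢ b → a ≢ c → b ≢ c → InducedSub 4 clawAdj G
  induced-claw {x} {a} {b} {c} xa xb xc ab ac bc a≢b a≢c b≢c =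
    g , pairwise-distinct⇒injective g distinct , adj-from-upper g clawAdj-sym clawAdj-irrefl upper
    where
    g : Fin 4 → Fin (n G)
    g 0F = x
    g 1F = a
    g 2F = b
    g 3F = c
    upper : ∀ {i j} → i < j → adj G (g i) (g j) ≡ clawAdj i j
    upper {0F} {1F} _ = xa
    upper {0F} {2F} _ = xb
    upper {0F} {3F} _ = xc
    upper {1F} {2F} _ = ab
    upper {1F} {3F} _ = ac
    upper {2F} {3F} _ = bc
    upper {j = 0F} ()
    upper {suc _} {1F} (s≤s ())
    upper {suc (suc _)} {2F} (s≤s (s≤s ()))
    upper {3F} {3F} (s≤s (s≤s (s≤s ())))
    distinct : ∀ {i j} → i < j → g i ≢ g j
    distinct {0F} {1F} _ = adjacent⇒≢ xa
    distinct {0F} {2F} _ = adjacent⇒≢ xb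
    distinct {0F} {3F} _ = adjacent⇒≢ xc
    distinct {1F} {2F} _ = a≢b
    distinct {1F} {3F} _ = a≢c
    distinct {2F} {3F} _ = b≢c
    distinct {j = 0F} ()
    distinct {suc _} {1F} (s≤s ())
    distinct {suc (suc _)} {2F} (s≤s (s≤s ()))
    distinct {3F} {3F} (s≤s (s≤s (s≤s ())))

  induced-net : ∀ {x y z p q r} →
    adj G x y ≡ true  → adj G x z ≡ true  → adj G x p ≡ true  → adj G x q ≡ false → adj G x r ≡ false →
    adj G y z ≡ true  → adj G y p ≡ false → adj G y q ≡ true  → adj G y r ≡ false →
    adj G z p ≡ false → adj G z q ≡ false → adj G z r ≡ true  →
    adj G p q ≡ false → adj G p r ≡ false →
    adj G q r ≡ false →
    InducedSub 6 netAdj G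
  induced-net {x} {y} {z} {p} {q} {r} xy xz xp xq xr yz yp yq yr zp zq zr pq pr qr =
    g , twinFree⇒injective g netAdj-twinFree g-adj , g-adj
    where
    g : Fin 6 → Fin (n G)
    g 0F = x
    g 1F = y
    g 2F = z
    g 3F = p
    g 4F = q
    g 5F = r
    upper : ∀ {i j} → i < j → adj G (g i) (g j) ≡ netAdj i j
    upper {0F} {1F} _ = xy
    upper {0F} {2F} _ = xz
    upper {0F} {3F} _ = xp
    upper {0F} {4F} _ = xq
    upper {0F} {5F} _ = xr
    upper {1F} {2F} _ = yz
    upper {1F} {3F} _ = yp
    upper {1F} {4F} _ = yq
    upper {1F} {5F} _ = yr
    upper {2F} {3F} _ = zp
    upper {2F} {4F} _ = zq
    upper {2F} {5F} _ = zr
    upper {3F} {4F} _ = pq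
    upper {3F} {5F} _ = pr
    upper {4F} {5F} _ = qr
    upper {j = 0F} ()
    upper {suc _} {1F} (s≤s ())
    upper {suc (suc _)} {2F} (s≤s (s≤s ()))
    upper {suc (suc (suc _))} {3F} (s≤s (s≤s (s≤s ())))
    upper {suc (suc (suc (suc _)))} {4F} (s≤s (s≤s (s≤s (s≤s ()))))
    upper {5F} {5F} (s≤s (s≤s (s≤s (s≤s (s≤s ())))))
    g-adj : ∀ i j → adj G (g i) (g j) ≡ netAdj i j
    g-adj = adj-from-upper g netAdj-sym netAdj-irrefl upper

record InducedPath₄ (G : Graph) (x₀ x₁ x₂ x₃ : Fin (n G)) : Set where
  field
    adj₀₁    : adj G x₀ x₁ ≡ true
    adj₁₂    : adj G x₁ x₂ ≡ true
    adj₂₃    : adj G x₂ x₃ ≡ true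
    nonadj₀₂ : adj G x₀ x₂ ≡ false
    nonadj₁₃ : adj G x₁ x₃ ≡ false
    nonadj₀₃ : adj G x₀ x₃ ≡ false

module ClawNetFree (G : Graph) (claw-free : ¬ InducedSub 4 clawAdj G) (net-free : ¬ InducedSub 6 netAdj G) where

  P₄-middle⇒no-far-neighbour : ∀ {x₀ x₁ x₂ x₃ u v} → InducedPath₄ G x₀ x₁ x₂ x₃ →
    adj G v x₁ ≡ true → adj G v x₂ ≡ true → adj G u v ≡ true →
    adj G u x₀ ≡ false → adj G u x₁ ≡ false → adj G u x₂ ≡ false → adj G u x₃ ≡ false → ⊥
  P₄-middle⇒no-far-neighbour {x₀} {x₃ = x₃} {v = v} path vx₁ vx₂ uv ux₀ ux₁ ux₂ ux₃
    with adj G v x₀ in vx₀ | adj G v x₃ in vx₃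
  ... | true | _ = claw-free (induced-claw G (adj-flip G uv) vx₀ vx₂ ux₀ ux₂ nonadj₀₂
          (separated G (adj-flip G ux₁) (adj-flip G adj₀₁))
          (separated G (adj-flip G ux₁) adj₁₂)
          (separated G (adj-flip G nonadj₀₃) (adj-flip G adj₂₃)))
    where open InducedPath₄ path
  ... | false | true = claw-free (induced-claw G (adj-flip G uv) vx₁ vx₃ ux₁ ux₃ nonadj₁₃
          (separated G (adj-flip G ux₀) adj₀₁)
          (separated G (adj-flip G ux₂) adj₂₃)
          (≢-sym (separated G nonadj₀₃ adj₀₁)))
    where open InducedPath₄ path
  ... | false | false = net-free (induced-net G
          vx₁ vx₂ (adj-flip G uv) vx₀ vx₃
          adj₁₂ (adj-flip G ux₁) (adj-flip G adj₀₁) nonadj₁₃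
          (adj-flip G ux₂) (adj-flip G nonadj₀₂) adj₂₃
          ux₀ ux₃
          nonadj₀₃)
    where open InducedPath₄ path

data Step (ℓ a : ℕ) : ℕ → Set where
  wrap   : suc a ≡ ℓ → Step ℓ a 0
  nowrap : suc a ≢ ℓ → Step ℓ a (suc a)

CycAdjacent : ℕ → ℕ → ℕ → Set
CycAdjacent ℓ a b = b ≡ suc a ⊎ a ≡ suc b ⊎ (a ≡ 0 × suc b ≡ ℓ) ⊎ (b ≡ 0 × suc a ≡ ℓ)

step⇒cycAdjacent : ∀ {ℓ a b} → Step ℓ a b → CycAdjacent ℓ a b
step⇒cycAdjacent (wrap p)   = inj₂ (inj₂ (inj₂ (refl , p)))
step⇒cycAdjacent (nowrap _) = inj₁ refl

step²-cycAdjacent⇒≱4 : ∀ {ℓ a b c} → Step ℓ a b → Step ℓ b c → CycAdjacent ℓ a c → ¬ 4 ≤ ℓ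
step²-cycAdjacent⇒≱4 (wrap refl) (wrap refl) _ (s≤s ())
step²-cycAdjacent⇒≱4 (wrap refl) (nowrap _) (inj₂ (inj₁ refl)) (s≤s (s≤s (s≤s ())))
step²-cycAdjacent⇒≱4 (wrap refl) (nowrap _) (inj₂ (inj₂ (inj₂ (() , _)))) _
step²-cycAdjacent⇒≱4 (nowrap _) (wrap refl) (inj₂ (inj₁ refl)) (s≤s (s≤s (s≤s ())))
step²-cycAdjacent⇒≱4 (nowrap _) (wrap refl) (inj₂ (inj₂ (inj₁ (refl , ())))) _
step²-cycAdjacent⇒≱4 (nowrap ¬wrap) (wrap _) (inj₂ (inj₂ (inj₂ (_ , wraps)))) _ = ¬wrap wraps
step²-cycAdjacent⇒≱4 (nowrap _) (nowrap _) (inj₂ (inj₂ (inj₁ (refl , refl)))) (s≤s (s≤s (s≤s ())))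

step³-cycAdjacent⇒≱5 : ∀ {ℓ a b c d} → Step ℓ a b → Step ℓ b c → Step ℓ c d → CycAdjacent ℓ a d → ¬ 5 ≤ ℓ
step³-cycAdjacent⇒≱5 (wrap refl) (wrap refl) _ _ (s≤s ())
step³-cycAdjacent⇒≱5 (wrap refl) (nowrap _) (wrap refl) _ (s≤s (s≤s ()))
step³-cycAdjacent⇒≱5 (wrap refl) (nowrap _) (nowrap _) (inj₁ refl) (s≤s (s≤s ()))
step³-cycAdjacent⇒≱5 (wrap refl) (nowrap _) (nowrap _) (inj₂ (inj₁ refl)) (s≤s (s≤s (s≤s (s≤s ()))))
step³-cycAdjacent⇒≱5 (wrap refl) (nowrap _) (nowrap _) (inj₂ (inj₂ (inj₁ (refl , ())))) _
step³-cycAdjacent⇒≱5 (wrap refl) (nowrap _) (nowrap _) (inj₂ (inj₂ (inj₂ (() , _)))) _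
step³-cycAdjacent⇒≱5 (nowrap _) (wrap refl) (nowrap _) (inj₁ refl) (s≤s (s≤s ()))
step³-cycAdjacent⇒≱5 (nowrap _) (wrap refl) (nowrap _) (inj₂ (inj₁ refl)) (s≤s (s≤s (s≤s (s≤s ()))))
step³-cycAdjacent⇒≱5 (nowrap _) (wrap refl) (nowrap _) (inj₂ (inj₂ (inj₁ (refl , refl)))) (s≤s (s≤s ()))
step³-cycAdjacent⇒≱5 (nowrap _) (wrap refl) (nowrap _) (inj₂ (inj₂ (inj₂ (() , _)))) _
step³-cycAdjacent⇒≱5 (nowrap _) (nowrap _) (wrap refl) (inj₂ (inj₁ refl)) (s≤s (s≤s (s≤s (s≤s ()))))
step³-cycAdjacent⇒≱5 (nowrap _) (nowrap _) (wrap refl) (inj₂ (inj₂ (inj₁ (refl , ())))) _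
step³-cycAdjacent⇒≱5 (nowrap ¬wrap) (nowrap _) (wrap _) (inj₂ (inj₂ (inj₂ (_ , wraps)))) _ = ¬wrap wraps
step³-cycAdjacent⇒≱5 (nowrap _) (nowrap _) (nowrap _) (inj₂ (inj₂ (inj₁ (refl , refl)))) (s≤s (s≤s (s≤s (s≤s ()))))

T-== : ∀ m k → T (m == k) ⇔ m ≡ k
T-== m k = mk⇔ (≡ᵇ⇒≡ m k) (≡⇒≡ᵇ m k)

infixr 6 _⟨∨⟩_
infixr 7 _⟨∧⟩_

_⟨∨⟩_ : ∀ {x y} {A B : Set} → T x ⇔ A → T y ⇔ B → T (x ∨ y) ⇔ (A ⊎ B)
p ⟨∨⟩ q = (p ⊎-⇔ q) ⇔-∘ T-∨

_⟨∧⟩_ : ∀ {x y} {A B : Set} → T x ⇔ A → T y ⇔ B → T (x ∧ y) ⇔ (A × B)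
p ⟨∧⟩ q = (p ×-⇔ q) ⇔-∘ T-∧

T-cycAdj : ∀ {ℓ} (i j : Fin ℓ) → T (cycAdj ℓ i j) ⇔ CycAdjacent ℓ (toℕ i) (toℕ j)
T-cycAdj i j = T-== _ _ ⟨∨⟩ T-== _ _ ⟨∨⟩ T-== _ _ ⟨∧⟩ T-== _ _ ⟨∨⟩ T-== _ _ ⟨∧⟩ T-== _ _

cycAdjacent⇒cycAdj : ∀ {ℓ} {i j : Fin ℓ} → CycAdjacent ℓ (toℕ i) (toℕ j) → cycAdj ℓ i j ≡ true
cycAdjacent⇒cycAdj {i = i} {j} = Equivalence.to T-≡ ∘ Equivalence.from (T-cycAdj i j)

¬cycAdjacent⇒¬cycAdj : ∀ {ℓ} {i j : Fin ℓ} → ¬ CycAdjacent ℓ (toℕ i) (toℕ j) → cycAdj ℓ i j ≡ false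
¬cycAdjacent⇒¬cycAdj {i = i} {j} ¬adjacent =
  ¬-not (¬adjacent ∘ Equivalence.to (T-cycAdj i j) ∘ Equivalence.from T-≡)

Consecutive : ∀ {ℓ} → Fin ℓ → Fin ℓ → Set
Consecutive {ℓ} i j = Step ℓ (toℕ i) (toℕ j)

last-consecutive-zero : ∀ m → Consecutive (fromℕ m) zero
last-consecutive-zero m = wrap (cong suc (toℕ-fromℕ m))

inject₁-consecutive-suc : ∀ {m} (j : Fin m) → Consecutive (inject₁ j) (suc j)
inject₁-consecutive-suc {m} j = subst (λ a → Step (suc m) a (suc (toℕ j))) (sym (toℕ-inject₁ j))
  (nowrap (<⇒≢ (s≤s (toℕ<n j))))

successor : ∀ {m} (i : Fin (suc m)) → ∃[ j ] Consecutive i j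
successor i with view i
... | ‵fromℕ       = zero , last-consecutive-zero _
... | ‵inject₁ j = suc j , inject₁-consecutive-suc j

predecessor : ∀ {m} (i : Fin (suc m)) → ∃[ j ] Consecutive j i
predecessor {m} zero = fromℕ m , last-consecutive-zero m
predecessor (suc j)  = inject₁ j , inject₁-consecutive-suc j

module InducedCycle (G : Graph) {m} (c : Fin (suc m) → Fin (n G))
  (c-adj : ∀ i j → adj G (c i) (c j) ≡ cycAdj (suc m) i j) where

  consecutive-adjacent : ∀ {i j} → Consecutive i j → adj G (c i) (c j) ≡ true
  consecutive-adjacent i→j = trans (c-adj _ _) (cycAdjacent⇒cycAdj (step⇒cycAdjacent i→j))

  cycle-path : 5 ≤ suc m → ∀ {i j k l} → Consecutive i j → Consecutive j k → Consecutive k l →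
    InducedPath₄ G (c i) (c j) (c k) (c l)
  cycle-path 5≤ℓ i→j j→k k→l = record
    { adj₀₁    = consecutive-adjacent i→j
    ; adj₁₂    = consecutive-adjacent j→k
    ; adj₂₃    = consecutive-adjacent k→l
    ; nonadj₀₂ = nonadjacent λ i~k → step²-cycAdjacent⇒≱4 i→j j→k i~k (<⇒≤ 5≤ℓ)
    ; nonadj₁₃ = nonadjacent λ j~l → step²-cycAdjacent⇒≱4 j→k k→l j~l (<⇒≤ 5≤ℓ)
    ; nonadj₀₃ = nonadjacent λ i~l → step³-cycAdjacent⇒≱5 i→j j→k k→l i~l 5≤ℓ
    }
    where
    nonadjacent : ∀ {x y} → ¬ CycAdjacent (suc m) (toℕ x) (toℕ y) → adj G (c x) (c y) ≡ false
    nonadjacent ¬x~y = trans (c-adj _ _) (¬cycAdjacent⇒¬cycAdj ¬x~y)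

  Far : Fin (n G) → Set
  Far u = ∀ i → adj G u (c i) ≡ false

  cycle-vertex-not-far : ∀ i → ¬ Far (c i)
  cycle-vertex-not-far i far with successor i
  ... | j , i→j = contradiction (trans (sym (far j)) (consecutive-adjacent i→j)) λ ()

walk-preserves : ∀ {G} (P : Fin (n G) → Set) → (∀ {u v} → adj G u v ≡ true → P u → P v) →
  ∀ {s t} → Walk G s t → P s → P t
walk-preserves P edge-preserves here          Ps = Ps
walk-preserves P edge-preserves (step uv walk) Ps = walk-preserves P edge-preserves walk (edge-preserves uv Ps)

module FarFromCycle (G : Graph) (claw-free : ¬ InducedSub 4 clawAdj G) (net-free : ¬ InducedSub 6 netAdj G)
  {m} (c : Fin (suc m) → Fin (n G)) (c-adj : ∀ i j → adj G (c i) (c j) ≡ cycAdj (suc m) i j)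
  (5≤ℓ : 5 ≤ suc m) where
  open ClawNetFree G claw-free net-free
  open InducedCycle G c c-adj

  cycle-neighbour⇒no-far-neighbour : ∀ {u v i} → adj G v (c i) ≡ true → adj G u v ≡ true → ¬ Far u
  cycle-neighbour⇒no-far-neighbour {u} {v} {i} vi uv far
    with predecessor i | successor i
  ... | p , p→i | s , i→s
    with predecessor p | successor s
  ... | p′ , p′→p | s′ , s→s′
    with adj G v (c s) in vs | adj G v (c p) in vp
  ... | true | _ =
    P₄-middle⇒no-far-neighbour (cycle-path 5≤ℓ p→i i→s s→s′) vi vs uv (far p) (far i) (far s) (far s′)
  ... | false | true =
    P₄-middle⇒no-far-neighbour (cycle-path 5≤ℓ p′→p p→i i→s) vp vi uv (far p′) (far p) (far i) (far s)
  ... | false | false =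
    claw-free (induced-claw G (adj-flip G adj₀₁) adj₁₂ (adj-flip G vi)
      nonadj₀₂ (adj-flip G vp) (adj-flip G vs)
      (separated G (adj-flip G nonadj₀₃) (adj-flip G adj₂₃)) (separated G (far p) uv) (separated G (far s) uv))
    where open InducedPath₄ (cycle-path 5≤ℓ p→i i→s s→s′)

  far-neighbour-far : ∀ {u v} → adj G u v ≡ true → Far u → Far v
  far-neighbour-far {v = v} uv far i with adj G v (c i) in vi
  ... | true  = contradiction far (cycle-neighbour⇒no-far-neighbour vi uv)
  ... | false = refl

lemma2p3 : (G : Graph) → Connected G →
    ¬ InducedSub 4 clawAdj G → ¬ InducedSub 6 netAdj G →
    (ℓ : ℕ) → (h : ℓ ≥ 5) → ¬ InducedSub (suc ℓ) (cycStarAdj ℓ) G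
lemma2p3 G connected claw-free net-free (suc m) 5≤ℓ (f , _ , f-adj) =
  cycle-vertex-not-far 0F (walk-preserves Far far-neighbour-far (connected (f 0F) (c 0F)) isolated-far)
  where
  c : Fin (suc m) → Fin (n G)
  c = f ∘ suc
  c-adj : ∀ i j → adj G (c i) (c j) ≡ cycAdj (suc m) i j
  c-adj i j = f-adj (suc i) (suc j)
  open InducedCycle G c c-adj
  open FarFromCycle G claw-free net-free c c-adj 5≤ℓ
  isolated-far : Far (f 0F)
  isolated-far i = f-adj 0F (suc i)
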